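{- Let $(T,t)$ be a tiered tree of size $n$. Then there exists a function $t':[n]\to[n]$ such that $(T,t')$ is a fully tiered tree.
   Context: A tiered tree of size $n$ is a pair $(T,t)$ where $T$ is a labeled tree on vertex set $[n]$ and $t:[n]\to[k]$ is a surjection (for some $k$) such that for every edge $\{i,j\}$ of $T$ with $i>j$ we have $t(i)<t(j)$. It is fully tiered if $k=n$, i.e. $t$ is a bijection. -}

module Defs where

open import Data.Nat using (ℕ; suc; _≤_)
open import Data.Fin using (Fin) renaming (_<_ to _<ᶠ_)
open import Data.Bool using (Bool; true)
open import Data.List using (List; []; _∷_; length; last)
open import Data.List.Relation.Unary.Unique.Propositional using (Unique)
open import Data.Maybe using (just)
open import Data.Product using (Σ; ∃; _×_; _,_)
open import Data.Unit using (⊤)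
open import Relation.Nullary using (¬_)
open import Relation.Binary.PropositionalEquality using (_≡_)
open import Function.Definitions using (Surjective; Bijective)

record Graph (n : ℕ) : Set where
  field
    adj   : Fin n → Fin n → Bool
    sym   : ∀ i j → adj i j ≡ true → adj j i ≡ true
    irrefl : ∀ i → ¬ (adj i i ≡ true)
open Graph public

Edge : ∀ {n} → Graph n → Fin n → Fin n → Set
Edge G i j = adj G i j ≡ true

Chain : ∀ {n} → Graph n → List (Fin n) → Set
Chain G []           = ⊤
Chain G (x ∷ [])     = ⊤
Chain G (x ∷ y ∷ xs) = Edge G x y × Chain G (y ∷ xs)

record Path {n} (G : Graph n) (u v : Fin n) : Set where
  field
    verts    : List (Fin n)
    starts   : Σ (List (Fin n)) (λ rest → verts ≡ u ∷ rest)
    ends     : last verts ≡ just v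
    chain    : Chain G verts
    distinct : Unique verts

record Cycle {n} (G : Graph n) : Set where
  field
    first    : Fin n
    lastv    : Fin n
    verts    : List (Fin n)
    starts   : Σ (List (Fin n)) (λ rest → verts ≡ first ∷ rest)
    ends     : last verts ≡ just lastv
    long     : 3 ≤ length verts
    chain    : Chain G verts
    closing  : Edge G lastv first
    distinct : Unique verts

Connected : ∀ {n} → Graph n → Set
Connected G = ∀ u v → Path G u v

Acyclic : ∀ {n} → Graph n → Set
Acyclic G = ¬ Cycle G

record Tree (n : ℕ) : Set where
  field
    graph     : Graph n
    connected : Connected graph
    acyclic   : Acyclic graph
open Tree public

TierCondition : ∀ {n k} → Tree n → (Fin n → Fin k) → Set
TierCondition T t = ∀ i j → Edge (graph T) i j → j <ᶠ i → t i <ᶠ t j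

IsTiered : ∀ {n k} → Tree n → (Fin n → Fin k) → Set
IsTiered T t = Surjective _≡_ _≡_ t × TierCondition T t

-- (T,t) is fully tiered: tiered with k = n, i.e. t : [n] → [n] a bijection
IsFullyTiered : ∀ {n} → Tree n → (Fin n → Fin n) → Set
IsFullyTiered T t = Bijective _≡_ _≡_ t × TierCondition T t

-- Order the vertices lexicographically by (t i, i) and send each vertex to the
-- number of vertices strictly below it. Since this order is total, the map is a
-- bijection [n] → [n]; since it refines the order by tier, it is strictly
-- monotone in t and so inherits the tier condition.
module Submission where

open import Defs using (Tree; IsTiered; IsFullyTiered)
open import Data.Nat as ℕ using (ℕ; suc; _*_)
open import Data.Nat.Properties using (n<1+n)
open import Data.Fin as Fin using (Fin; fromℕ<; punchOut; combine)
open import Data.Fin.Properties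
  using (any?; punchOut-injective; <⇒notInjective; toℕ-fromℕ<; <⇒≢;
         <-strictTotalOrder; combine-monoˡ-<; combine-injectiveʳ)
  renaming (_≟_ to _≟ᶠ_)
open import Data.Fin.Subset using (Subset; ⊤; ∣_∣; _∈_; _∉_; _⊂_)
open import Data.Fin.Subset.Properties using (∈⊤; ∣⊤∣≡n; p⊂q⇒∣p∣<∣q∣)
open import Data.Vec using (tabulate)
open import Data.Vec.Properties using (lookup∘tabulate; []=⇒lookup; lookup⇒[]=)
open import Data.Empty using (⊥-elim)
open import Data.Product using (∃; _,_)
open import Relation.Binary using (StrictTotalOrder; tri<; tri≈; tri>)
open import Relation.Nullary using (does; yes; no; contradiction)
open import Relation.Nullary.Decidable using (dec-true)
open import Relation.Binary.PropositionalEquality as ≡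
  using (_≡_; _≢_; subst; subst₂)
open import Function.Definitions
  using (Injective; StrictlySurjective; Bijective)
open import Function.Consequences.Propositional using (strictlySurjective⇒surjective)

injective⇒strictlySurjective : ∀ {n} {f : Fin n → Fin n} →
  Injective _≡_ _≡_ f → StrictlySurjective _≡_ f
injective⇒strictlySurjective {suc m} {f} f-inj y with any? (λ x → f x ≟ᶠ y)
... | yes hit = hit
... | no miss = ⊥-elim (<⇒notInjective (n<1+n m) g-inj)
  where
  y≢f : ∀ x → y ≢ f x
  y≢f x y≡fx = miss (x , ≡.sym y≡fx)

  g : Fin (suc m) → Fin m
  g x = punchOut (y≢f x)

  g-inj : Injective _≡_ _≡_ g
  g-inj gx≡gx′ = f-inj (punchOut-injective (y≢f _) (y≢f _) gx≡gx′)

module Rank {c ℓ₁ ℓ₂} (S : StrictTotalOrder c ℓ₁ ℓ₂) {n}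
            (f : Fin n → StrictTotalOrder.Carrier S) where

  open StrictTotalOrder S using (_≈_; _<_; _<?_; compare; trans; irrefl; module Eq)

  below : Fin n → Subset n
  below i = tabulate (λ j → does (f j <? f i))

  ∈-below⁺ : ∀ {i j} → f j < f i → j ∈ below i
  ∈-below⁺ {i} {j} fj<fi =
    lookup⇒[]= j (below i) (≡.trans (lookup∘tabulate _ j) (dec-true (f j <? f i) fj<fi))

  ∈-below⁻ : ∀ {i j} → j ∈ below i → f j < f i
  ∈-below⁻ {i} {j} j∈below
    with f j <? f i | ≡.trans (≡.sym (lookup∘tabulate _ j)) ([]=⇒lookup j∈below)
  ... | yes fj<fi | _ = fj<fi
  ... | no _      | ()

  ∉-below-self : ∀ i → i ∉ below i
  ∉-below-self i i∈below = irrefl Eq.refl (∈-below⁻ i∈below)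

  below⊂⊤ : ∀ i → below i ⊂ ⊤
  below⊂⊤ i = (λ _ → ∈⊤) , i , ∈⊤ , ∉-below-self i

  below-mono-⊂ : ∀ {i j} → f i < f j → below i ⊂ below j
  below-mono-⊂ {i} fi<fj =
    (λ k∈below → ∈-below⁺ (trans (∈-below⁻ k∈below) fi<fj)) , i , ∈-below⁺ fi<fj , ∉-below-self i

  rank : Fin n → Fin n
  rank i = fromℕ< (subst (∣ below i ∣ ℕ.<_) (∣⊤∣≡n n) (p⊂q⇒∣p∣<∣q∣ (below⊂⊤ i)))

  rank-mono-< : ∀ {i j} → f i < f j → rank i Fin.< rank j
  rank-mono-< fi<fj =
    subst₂ ℕ._<_ (≡.sym (toℕ-fromℕ< _)) (≡.sym (toℕ-fromℕ< _)) (p⊂q⇒∣p∣<∣q∣ (below-mono-⊂ fi<fj))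

  rank-injective : Injective _≡_ _≈_ f → Injective _≡_ _≡_ rank
  rank-injective f-inj {i} {j} ri≡rj with compare (f i) (f j)
  ... | tri< fi<fj _ _ = contradiction ri≡rj (<⇒≢ (rank-mono-< fi<fj))
  ... | tri≈ _ fi≈fj _ = f-inj fi≈fj
  ... | tri> _ _ fj<fi = contradiction (≡.sym ri≡rj) (<⇒≢ (rank-mono-< fj<fi))

  rank-bijective : Injective _≡_ _≈_ f → Bijective _≡_ _≡_ rank
  rank-bijective f-inj =
    rank-inj , strictlySurjective⇒surjective (injective⇒strictlySurjective rank-inj)
    where
    rank-inj : Injective _≡_ _≡_ rank
    rank-inj = rank-injective f-inj

lemma2p4 : (n k : ℕ) (T : Tree n) (t : Fin n → Fin k) → IsTiered T t →
    ∃ λ (t′ : Fin n → Fin n) → IsFullyTiered T t′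
lemma2p4 n k T t (_ , tier) =
  rank , rank-bijective key-injective ,
  λ i j i~j j<i → rank-mono-< (combine-monoˡ-< i j (tier i j i~j j<i))
  where
  -- toℕ (combine a i) = n * toℕ a + toℕ i, so key realises the lexicographic order.
  key : Fin n → Fin (k * n)
  key i = combine (t i) i

  key-injective : Injective _≡_ _≡_ key
  key-injective {i} {j} = combine-injectiveʳ (t i) i (t j) j

  open Rank (<-strictTotalOrder (k * n)) key
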